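{- Let $3\le\alpha\le\omega$ and let $(A_\beta)_{\beta<\alpha}$ be a partition of $\mathbb{N}$ into nonempty pairwise disjoint sets. Then the coloring associated to this partition is reconstructible.
   Context: A coloring on a set $X$ is a function $\varphi:[X]^2\to\{0,1\}$, where $[X]^2$ is the set of $2$-element subsets of $X$. The coloring associated to a partition $(A_\beta)_\beta$ of $X$ is given by $\varphi(\{x,y\})=1$ iff $x,y\in A_\beta$ for some $\beta$. $\mathrm{hom}(\varphi)=\{H\subseteq X:\ |H|>2 \text{ and } \varphi \text{ is constant on } [H]^2\}$. A coloring $\varphi$ on $X$ is reconstructible if for every coloring $\psi$ on $X$ with $\mathrm{hom}(\psi)=\mathrm{hom}(\varphi)$ one has $\psi=\varphi$ or $\psi=1-\varphi$. -}

module Defs where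

open import Data.Nat using (ℕ; _<_; _≤_)
open import Data.Fin using (Fin)
import Data.Fin as Fin
import Data.Nat as Nat
open import Data.Bool using (Bool; true; false; not)
open import Data.Unit using (⊤)
open import Data.Product using (Σ; ∃; ∃-syntax; _×_; _,_)
open import Data.Sum using (_⊎_)
open import Relation.Binary.PropositionalEquality using (_≡_; _≢_)
open import Relation.Nullary using (does)
open import Relation.Binary using (DecidableEquality)
open import Function.Bundles using (_⇔_)
open import Level using (Level; 0ℓ)
open import Relation.Unary using (Pred; _∈_)

data Card : Set where
  fin : ℕ → Card
  ω   : Card

Index : Card → Set
Index (fin n) = Fin n
Index ω       = ℕ

_≟I_ : {α : Card} → DecidableEquality (Index α)
_≟I_ {fin n} = Fin._≟_
_≟I_ {ω}     = Nat._≟_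

3≤ : Card → Set
3≤ (fin n) = 3 ≤ n
3≤ ω       = ⊤

-- A partition of ℕ into pieces A_β (β < α) is given by the map
-- x ↦ the unique β with x ∈ A_β; pieces are pairwise disjoint and
-- cover ℕ automatically. Nonemptiness of every piece = surjectivity.
AllNonempty : {α : Card} → (ℕ → Index α) → Set
AllNonempty {α} p = (β : Index α) → ∃[ x ] p x ≡ β

-- A coloring φ : [ℕ]² → {0,1}, represented by c with φ({x,y}) = c x y
-- for x < y (values of c at x ≥ y are irrelevant). 1 = true, 0 = false.
Coloring : Set
Coloring = ℕ → ℕ → Bool

assocColoring : {α : Card} → (ℕ → Index α) → Coloring
assocColoring p x y = does (p x ≟I p y)

Hom : Coloring → Pred ℕ 0ℓ → Set
Hom φ H =
  (∃[ x ] ∃[ y ] ∃[ z ] (x ∈ H × y ∈ H × z ∈ H × x ≢ y × y ≢ z × x ≢ z))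
  × (∃[ b ] ∀ x y → x ∈ H → y ∈ H → x < y → φ x y ≡ b)

SameHom : Coloring → Coloring → Set₁
SameHom ψ φ = (H : Pred ℕ 0ℓ) → Hom ψ H ⇔ Hom φ H

_≐_ : Coloring → Coloring → Set
ψ ≐ φ = ∀ x y → x < y → ψ x y ≡ φ x y

compl : Coloring → Coloring
compl φ x y = not (φ x y)

Reconstructible : Coloring → Set₁
Reconstructible φ = (ψ : Coloring) → SameHom ψ φ → (ψ ≐ φ) ⊎ (ψ ≐ compl φ)

-- Distinct points x, y, z of ℕ lying in three different pieces form a
-- 0-homogeneous triangle for the partition colouring φ, hence a ψ-homogeneous
-- one.  Since there are at least three pieces, any two edges joining different
-- pieces are linked by such triangles, so ψ takes one value c on all of them.
-- For an edge {x, y} inside a piece, pick z in another piece: if ψ {x, y} were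
-- c, then {x, y, z} would be ψ-homogeneous, hence φ-homogeneous, which it is
-- not.  So ψ = c xor φ, i.e. ψ = φ or ψ = 1 - φ.
module Submission where

open import Defs
open import Data.Nat using (ℕ; _<_; s≤s)
open import Data.Nat.Properties using (<-cmp; <-irrefl)
import Data.Fin as Fin
open import Data.Bool using (Bool; true; false; not; _xor_)
open import Data.Bool.Properties using (¬-not; xor-comm; xor-identityʳ)
open import Data.Empty using (⊥-elim)
open import Data.Product using (∃-syntax; _×_; _,_)
open import Data.Sum using (_⊎_; inj₁; inj₂)
open import Relation.Binary using (DecidableEquality; tri<; tri≈; tri>)
open import Relation.Binary.PropositionalEquality
  using (_≡_; _≢_; refl; sym; trans; module ≡-Reasoning)
open import Relation.Nullary using (yes; no)
open import Relation.Nullary.Decidable using (dec-true; dec-false)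
open import Function.Bundles using (Equivalence)
open import Level using (0ℓ)
open import Relation.Unary using (Pred)

Distinct₃ : {A : Set} → A → A → A → Set
Distinct₃ a b c = a ≢ b × b ≢ c × a ≢ c

avoid-two : {A : Set} → DecidableEquality A → {a b c : A} → Distinct₃ a b c →
  (i j : A) → ∃[ k ] k ≢ i × k ≢ j
avoid-two _≟_ {a} {b} {c} (a≢b , b≢c , a≢c) i j with a ≟ i | a ≟ j
... | no a≢i | no a≢j = a , a≢i , a≢j
... | yes refl | _ with b ≟ j
...   | no b≢j   = b , (λ b≡a → a≢b (sym b≡a)) , b≢j
...   | yes refl = c , (λ c≡a → a≢c (sym c≡a)) , (λ c≡b → b≢c (sym c≡b))
avoid-two _≟_ {a} {b} {c} (a≢b , b≢c , a≢c) i j | no _ | yes refl with b ≟ i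
...   | no b≢i   = b , b≢i , (λ b≡a → a≢b (sym b≡a))
...   | yes refl = c , (λ c≡b → b≢c (sym c≡b)) , (λ c≡a → a≢c (sym c≡a))

three-indices : (α : Card) → 3≤ α → ∃[ a ] ∃[ b ] ∃[ c ] Distinct₃ {Index α} a b c
three-indices (fin _) (s≤s (s≤s (s≤s _))) =
  Fin.zero , Fin.suc Fin.zero , Fin.suc (Fin.suc Fin.zero) , (λ ()) , (λ ()) , (λ ())
three-indices ω _ = 0 , 1 , 2 , (λ ()) , (λ ()) , (λ ())

-- A Coloring is only meaningful above the diagonal; edge reads it on unordered pairs.
edge : Coloring → ℕ → ℕ → Bool
edge χ x y with <-cmp x y
... | tri< _ _ _ = χ x y
... | tri≈ _ _ _ = χ x y
... | tri> _ _ _ = χ y x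

edge-< : ∀ χ {x y} → x < y → edge χ x y ≡ χ x y
edge-< χ {x} {y} x<y with <-cmp x y
... | tri< _ _ _ = refl
... | tri≈ x≮y _ _ = ⊥-elim (x≮y x<y)
... | tri> x≮y _ _ = ⊥-elim (x≮y x<y)

edge-comm : ∀ χ {x y} → x ≢ y → edge χ x y ≡ edge χ y x
edge-comm χ {x} {y} x≢y with <-cmp x y | <-cmp y x
... | tri< _ _ y≮x | tri< y<x _ _ = ⊥-elim (y≮x y<x)
... | tri< _ _ _   | tri> _ _ _   = refl
... | tri> _ _ _   | tri< _ _ _   = refl
... | tri> x≮y _ _ | tri> _ _ x<y = ⊥-elim (x≮y x<y)
... | tri≈ _ x≡y _ | _            = ⊥-elim (x≢y x≡y)
... | _            | tri≈ _ y≡x _ = ⊥-elim (x≢y (sym y≡x))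

edge-of-symmetric : ∀ χ → (∀ x y → χ x y ≡ χ y x) → ∀ x y → edge χ x y ≡ χ x y
edge-of-symmetric χ χ-sym x y with <-cmp x y
... | tri< _ _ _ = refl
... | tri≈ _ _ _ = refl
... | tri> _ _ _ = χ-sym y x

edge-homogeneous : ∀ χ {H : Pred ℕ 0ℓ} {b} →
  (∀ x y → H x → H y → x < y → χ x y ≡ b) →
  ∀ {u v} → H u → H v → u ≢ v → edge χ u v ≡ b
edge-homogeneous χ const {u = u} {v} u∈H v∈H u≢v with <-cmp u v
... | tri< u<v _ _ = const u v u∈H v∈H u<v
... | tri≈ _ u≡v _ = ⊥-elim (u≢v u≡v)
... | tri> _ _ v<u = const v u v∈H u∈H v<u

triangle : ℕ → ℕ → ℕ → Pred ℕ 0ℓ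
triangle x y z w = w ≡ x ⊎ w ≡ y ⊎ w ≡ z

hom-triangle : ∀ χ {x y z} b → Distinct₃ x y z →
  edge χ x y ≡ b → edge χ y z ≡ b → edge χ x z ≡ b → Hom χ (triangle x y z)
hom-triangle χ {x} {y} {z} b (x≢y , y≢z , x≢z) xy yz xz =
  (x , y , z , inj₁ refl , inj₂ (inj₁ refl) , inj₂ (inj₂ refl) , x≢y , y≢z , x≢z) ,
  (b , λ u v u∈T v∈T u<v →
         trans (sym (edge-< χ u<v)) (edges u∈T v∈T (λ u≡v → <-irrefl u≡v u<v)))
  where
  edges : ∀ {u v} → triangle x y z u → triangle x y z v → u ≢ v → edge χ u v ≡ b
  edges (inj₁ refl)        (inj₂ (inj₁ refl)) _   = xy
  edges (inj₁ refl)        (inj₂ (inj₂ refl)) _   = xz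
  edges (inj₂ (inj₁ refl)) (inj₂ (inj₂ refl)) _   = yz
  edges (inj₂ (inj₁ refl)) (inj₁ refl)        y≢x = trans (edge-comm χ y≢x) xy
  edges (inj₂ (inj₂ refl)) (inj₁ refl)        z≢x = trans (edge-comm χ z≢x) xz
  edges (inj₂ (inj₂ refl)) (inj₂ (inj₁ refl)) z≢y = trans (edge-comm χ z≢y) yz
  edges (inj₁ refl)        (inj₁ refl)        u≢u = ⊥-elim (u≢u refl)
  edges (inj₂ (inj₁ refl)) (inj₂ (inj₁ refl)) u≢u = ⊥-elim (u≢u refl)
  edges (inj₂ (inj₂ refl)) (inj₂ (inj₂ refl)) u≢u = ⊥-elim (u≢u refl)

hom-triangle-edges : ∀ χ {x y z} → x ≢ y → x ≢ z → Hom χ (triangle x y z) →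
  edge χ x y ≡ edge χ x z
hom-triangle-edges χ x≢y x≢z (_ , _ , const) =
  trans (edge-homogeneous χ const (inj₁ refl) (inj₂ (inj₁ refl)) x≢y)
        (sym (edge-homogeneous χ const (inj₁ refl) (inj₂ (inj₂ refl)) x≢z))

reconstruct-from-xor : ∀ ψ φ c → (∀ x y → x < y → ψ x y ≡ c xor φ x y) →
  (ψ ≐ φ) ⊎ (ψ ≐ compl φ)
reconstruct-from-xor ψ φ false ψ≡φ  = inj₁ ψ≡φ
reconstruct-from-xor ψ φ true  ψ≡¬φ = inj₂ ψ≡¬φ

module PartitionColoring {α : Card} (p : ℕ → Index α) where

  φ : Coloring
  φ = assocColoring p

  φ-sym : ∀ x y → φ x y ≡ φ y x
  φ-sym x y with p x ≟I p y
  ... | yes same = sym (dec-true (p y ≟I p x) (sym same))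
  ... | no differ = sym (dec-false (p y ≟I p x) (λ same → differ (sym same)))

  edge-φ-same : ∀ {x y} → p x ≡ p y → edge φ x y ≡ true
  edge-φ-same {x} {y} same = trans (edge-of-symmetric φ φ-sym x y) (dec-true (p x ≟I p y) same)

  edge-φ-different : ∀ {x y} → p x ≢ p y → edge φ x y ≡ false
  edge-φ-different {x} {y} differ =
    trans (edge-of-symmetric φ φ-sym x y) (dec-false (p x ≟I p y) differ)

  points-differ : ∀ {x y} → p x ≢ p y → x ≢ y
  points-differ differ refl = differ refl

  Rainbow : ℕ → ℕ → ℕ → Set
  Rainbow x y z = Distinct₃ (p x) (p y) (p z)

  rainbow-distinct : ∀ {x y z} → Rainbow x y z → Distinct₃ x y z
  rainbow-distinct (xy , yz , xz) = points-differ xy , points-differ yz , points-differ xz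

  rainbow-hom-φ : ∀ {x y z} → Rainbow x y z → Hom φ (triangle x y z)
  rainbow-hom-φ r@(xy , yz , xz) =
    hom-triangle φ false (rainbow-distinct r)
      (edge-φ-different xy) (edge-φ-different yz) (edge-φ-different xz)

module Reconstruction {α : Card} (h3 : 3≤ α) (p : ℕ → Index α) (surj : AllNonempty p)
                      (ψ : Coloring) (same-hom : SameHom ψ (assocColoring p)) where
  open PartitionColoring p
  open ≡-Reasoning

  other-piece : ∀ x y → ∃[ z ] p z ≢ p x × p z ≢ p y
  other-piece x y with three-indices α h3
  ... | _ , _ , _ , distinct with avoid-two _≟I_ distinct (p x) (p y)
  ...   | k , k≢px , k≢py with surj k
  ...     | z , refl = z , k≢px , k≢py

  rainbow-edges : ∀ {x y z} → Rainbow x y z → edge ψ x y ≡ edge ψ x z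
  rainbow-edges r@(xy , _ , xz) =
    hom-triangle-edges ψ (points-differ xy) (points-differ xz)
      (Equivalence.from (same-hom _) (rainbow-hom-φ r))

  cross-edges-at : ∀ {x y y'} → p x ≢ p y → p x ≢ p y' → edge ψ x y ≡ edge ψ x y'
  cross-edges-at {x} {y} {y'} xy xy' with p y ≟I p y'
  ... | no yy' = rainbow-edges (xy , yy' , xy')
  ... | yes same with other-piece x y
  ...   | z , zx , zy = begin
    edge ψ x y  ≡⟨ rainbow-edges (xy , (λ e → zy (sym e)) , (λ e → zx (sym e))) ⟩
    edge ψ x z  ≡⟨ rainbow-edges (xy' , (λ e → zy (trans (sym e) (sym same))) , (λ e → zx (sym e))) ⟨
    edge ψ x y' ∎

  -- Two cross edges are joined through a shared endpoint, or through a third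
  -- cross edge when their first endpoints lie in the same piece.
  cross-edges : ∀ {x y u v} → p x ≢ p y → p u ≢ p v → edge ψ x y ≡ edge ψ u v
  cross-edges {x} {y} {u} {v} xy uv with p x ≟I p u
  ... | no xu = begin
    edge ψ x y ≡⟨ cross-edges-at xy xu ⟩
    edge ψ x u ≡⟨ edge-comm ψ (points-differ xu) ⟩
    edge ψ u x ≡⟨ cross-edges-at (λ e → xu (sym e)) uv ⟩
    edge ψ u v ∎
  ... | yes same = begin
    edge ψ x y ≡⟨ cross-edges-at xy xv ⟩
    edge ψ x v ≡⟨ edge-comm ψ (points-differ xv) ⟩
    edge ψ v x ≡⟨ cross-edges-at (λ e → xv (sym e)) (λ e → uv (sym e)) ⟩
    edge ψ v u ≡⟨ edge-comm ψ (points-differ (λ e → uv (sym e))) ⟩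
    edge ψ u v ∎
    where
    xv : p x ≢ p v
    xv e = uv (trans (sym same) e)

  inner-edges : ∀ {x y u v} → x ≢ y → p x ≡ p y → p u ≢ p v →
    edge ψ x y ≡ not (edge ψ u v)
  inner-edges {x} {y} {u} {v} x≢y same uv with other-piece x x
  ... | z , zx , _ = ¬-not λ xy≡c →
    let xz : p x ≢ p z
        xz e = zx (sym e)
        yz : p y ≢ p z
        yz e = zx (sym (trans same e))
        ψ-hom = hom-triangle ψ (edge ψ u v) (x≢y , points-differ yz , points-differ xz)
                  xy≡c (cross-edges yz uv) (cross-edges xz uv)
        φ-xy≡xz = hom-triangle-edges φ x≢y (points-differ xz)
                    (Equivalence.to (same-hom _) ψ-hom)
    in true≢false (trans (sym (edge-φ-same same)) (trans φ-xy≡xz (edge-φ-different xz)))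
    where
    true≢false : true ≢ false
    true≢false ()

  ψ-formula : ∀ {u v} → p u ≢ p v → ∀ x y → x < y → ψ x y ≡ edge ψ u v xor φ x y
  ψ-formula {u} {v} uv x y x<y with p x ≟I p y
  ... | yes same = begin
    ψ x y                 ≡⟨ edge-< ψ x<y ⟨
    edge ψ x y            ≡⟨ inner-edges (λ e → <-irrefl e x<y) same uv ⟩
    not (edge ψ u v)      ≡⟨ xor-comm true (edge ψ u v) ⟩
    edge ψ u v xor true   ∎
  ... | no differ = begin
    ψ x y                 ≡⟨ edge-< ψ x<y ⟨
    edge ψ x y            ≡⟨ cross-edges differ uv ⟩
    edge ψ u v            ≡⟨ xor-identityʳ (edge ψ u v) ⟨
    edge ψ u v xor false  ∎

mainTheorem7 : (α : Card) → 3≤ α → (p : ℕ → Index α) → AllNonempty p →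
    Reconstructible (assocColoring p)
mainTheorem7 α h3 p surj ψ same-hom
  with three-indices α h3
... | a , b , _ , a≢b , _ with surj a | surj b
...   | u , refl | v , refl =
  reconstruct-from-xor ψ (assocColoring p) (edge ψ u v)
    (Reconstruction.ψ-formula h3 p surj ψ same-hom a≢b)
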